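{- A $\{0,1\}$-valued $d$-volume function $v$ on $K_n^{(d)}$ is extremal if and only if $v=v_C$ is the cut volume of some $d$-hypercut $C$. Moreover, if $v$ is such a cut volume and $v_1$ is any $d$-volume function, then $\mathrm{dist}(v,v_1)=\infty$ unless $v_1=\alpha v$ for some constant $\alpha>0$.
   Context: $V$ is a finite set, $|V|=n$, and $K_n^{(d)}$ is the set of $(d+1)$-subsets of $V$. Let $M_d$ be the $\mathbb{Z}_2$-incidence matrix between $(d-1)$-simplices and $d$-simplices ($M_d(\tau,\sigma)=1$ iff $\tau\subset\sigma$). A $d$-cycle is $Z\subseteq K_n^{(d)}$ with $M_d1_Z=0$ over $\mathbb{Z}_2$. For $A\subseteq K_n^{(d)}$, $\sigma$ is null homologous relative to $A$ if $1_{\{\sigma\}}$ lies in the $\mathbb{Z}_2$-span of the columns of $M_d$ indexed by $A$; $\sigma_1\sim\sigma_2\bmod A$ if $1_{\{\sigma_1\}}-1_{\{\sigma_2\}}$ does. A $d$-hypercut is a nonempty $C$ with no element null homologous relative to $K_n^{(d)}\setminus C$ and all elements pairwise $\sim\bmod(K_n^{(d)}\setminus C)$; $v_C$ is the indicator of $C$. A $d$-volume function is $v:K_n^{(d)}\to\mathbb{R}_{\ge0}$ with $\sum_{\sigma'\in Z\setminus\{\sigma\}}v(\sigma')\ge v(\sigma)$ for every $d$-cycle $Z$ and $\sigma\in Z$. The $d$-volumes form a convex cone; a nonzero volume $v$ is extremal if whenever $v=v_1+v_2$ with $v_1,v_2$ $d$-volumes, each $v_i$ is a nonnegative multiple of $v$.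 $\mathrm{dist}(v_1,v_2)=\max_\sigma\frac{v_1(\sigma)}{v_2(\sigma)}\cdot\max_\sigma\frac{v_2(\sigma)}{v_1(\sigma)}$, where a ratio $a/0$ with $a>0$ is $+\infty$ and ratios $0/0$ are ignored. -}

module Defs where

open import Data.Nat using (ℕ; zero; suc; _≟_)
open import Data.Bool using (Bool; true; false; _∧_; _∨_; not; _xor_; if_then_else_)
open import Data.Vec using (Vec; []; _∷_)
open import Data.List using (List; []; _∷_; _++_; map; mapMaybe; foldr)
open import Data.Maybe using (Maybe; just; nothing)
open import Data.Fin.Subset using (Subset; ∣_∣)
open import Data.Product using (Σ; ∃; ∃-syntax; _×_; _,_; proj₁)
open import Data.Sum using (_⊎_)
open import Relation.Nullary using (¬_; yes; no)
open import Relation.Binary.PropositionalEquality using (_≡_; _≢_)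

-- Scalars: an arbitrary (discrete-equality) ordered field.
-- The paper uses ℝ; ℝ is an instance of this record, so stating the
-- theorem for every ordered field covers the real case.

record OrderedField : Set₁ where
  infixl 6 _+_
  infixl 7 _*_
  infix 4 _≤_
  field
    Carrier : Set
    0# 1#   : Carrier
    _+_ _*_ : Carrier → Carrier → Carrier
    -_      : Carrier → Carrier
    _≤_     : Carrier → Carrier → Set
    +-assoc      : ∀ a b c → (a + b) + c ≡ a + (b + c)
    +-comm       : ∀ a b → a + b ≡ b + a
    +-identityˡ  : ∀ a → 0# + a ≡ a
    -‿inverseˡ   : ∀ a → (- a) + a ≡ 0#
    *-assoc      : ∀ a b c → (a * b) * c ≡ a * (b * c)
    *-comm       : ∀ a b → a * b ≡ b * a
    *-identityˡ  : ∀ a → 1# * a ≡ a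
    distribʳ     : ∀ a b c → (a + b) * c ≡ (a * c) + (b * c)
    0≢1          : 0# ≢ 1#
    inverse      : ∀ a → a ≢ 0# → ∃[ b ] (b * a ≡ 1#)
    ≤-refl       : ∀ a → a ≤ a
    ≤-trans      : ∀ {a b c} → a ≤ b → b ≤ c → a ≤ c
    ≤-antisym    : ∀ {a b} → a ≤ b → b ≤ a → a ≡ b
    ≤-total      : ∀ a b → a ≤ b ⊎ b ≤ a
    +-mono-≤     : ∀ {a b} c → a ≤ b → a + c ≤ b + c
    *-nonneg     : ∀ {a b} → 0# ≤ a → 0# ≤ b → 0# ≤ a * b

  _<_ : Carrier → Carrier → Set
  a < b = (a ≤ b) × (a ≢ b)

-- Vertex set V = Fin n.  Subsets of V are Data.Fin.Subset (Vec Bool n).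

allSubsets : (n : ℕ) → List (Subset n)
allSubsets zero    = [] ∷ []
allSubsets (suc n) = map (false ∷_) (allSubsets n) ++ map (true ∷_) (allSubsets n)

subB : ∀ {n} → Subset n → Subset n → Bool
subB []       []       = true
subB (x ∷ xs) (y ∷ ys) = (not x ∨ y) ∧ subB xs ys

eqB : ∀ {n} → Subset n → Subset n → Bool
eqB []       []       = true
eqB (x ∷ xs) (y ∷ ys) = not (x xor y) ∧ eqB xs ys

KSet : ℕ → ℕ → Set
KSet k n = Σ (Subset n) (λ s → ∣ s ∣ ≡ k)

-- d-simplices: (d+1)-subsets; (d-1)-simplices: d-subsets
Simplex : ℕ → ℕ → Set
Simplex d n = KSet (suc d) n

Face : ℕ → ℕ → Set
Face d n = KSet d n

allKSets : (k n : ℕ) → List (KSet k n)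
allKSets k n = mapMaybe pick (allSubsets n)
  where
  pick : Subset n → Maybe (KSet k n)
  pick s with ∣ s ∣ ≟ k
  ... | yes p = just (s , p)
  ... | no _  = nothing

simplices : (d n : ℕ) → List (Simplex d n)
simplices d n = allKSets (suc d) n

-- a set of d-simplices (= a Z₂ d-chain) is a Boolean predicate
Chain : ℕ → ℕ → Set
Chain d n = Simplex d n → Bool

-- M_d 1_A over Z₂ : for a face τ, parity of #{σ ∈ A : τ ⊂ σ}
boundary : ∀ {d n} → Chain d n → Face d n → Bool
boundary {d} {n} A τ =
  foldr (λ σ acc → (A σ ∧ subB (proj₁ τ) (proj₁ σ)) xor acc) false (simplices d n)

single : ∀ {d n} → Simplex d n → Chain d n
single σ σ' = eqB (proj₁ σ') (proj₁ σ)

compl : ∀ {d n} → Chain d n → Chain d n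
compl A σ = not (A σ)

IsCycle : ∀ {d n} → Chain d n → Set
IsCycle Z = ∀ τ → boundary Z τ ≡ false

-- x lies in the Z₂-span of the columns of M_d indexed by A
InSpan : ∀ {d n} → Chain d n → (Face d n → Bool) → Set
InSpan {d} {n} A x =
  Σ (Chain d n) (λ B → (∀ σ → B σ ≡ true → A σ ≡ true) × (∀ τ → boundary B τ ≡ x τ))

NullHomologous : ∀ {d n} → Chain d n → Simplex d n → Set
NullHomologous A σ = InSpan A (boundary (single σ))

HomEquiv : ∀ {d n} → Chain d n → Simplex d n → Simplex d n → Set
HomEquiv A σ₁ σ₂ = InSpan A (boundary (λ σ → single σ₁ σ xor single σ₂ σ))

IsHypercut : ∀ {d n} → Chain d n → Set
IsHypercut {d} {n} C =
  (∃[ σ ] C σ ≡ true)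
  × (∀ σ → C σ ≡ true → ¬ NullHomologous (compl C) σ)
  × (∀ σ₁ σ₂ → C σ₁ ≡ true → C σ₂ ≡ true → HomEquiv (compl C) σ₁ σ₂)

module Volumes (F : OrderedField) where
  open OrderedField F

  sumL : ∀ {A : Set} → List A → (A → Carrier) → Carrier
  sumL xs f = foldr (λ a acc → f a + acc) 0# xs

  IsVolume : ∀ {d n} → (Simplex d n → Carrier) → Set
  IsVolume {d} {n} v =
    (∀ σ → 0# ≤ v σ)
    × (∀ (Z : Chain d n) → IsCycle Z → ∀ σ → Z σ ≡ true →
         v σ ≤ sumL (simplices d n)
                    (λ σ' → if Z σ' ∧ not (eqB (proj₁ σ') (proj₁ σ)) then v σ' else 0#))

  IsExtremal : ∀ {d n} → (Simplex d n → Carrier) → Set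
  IsExtremal {d} {n} v =
    IsVolume v
    × (∃[ σ ] v σ ≢ 0#)
    × (∀ (v₁ v₂ : Simplex d n → Carrier) → IsVolume v₁ → IsVolume v₂ →
         (∀ σ → v σ ≡ v₁ σ + v₂ σ) →
         (∃[ α ] (0# ≤ α × (∀ σ → v₁ σ ≡ α * v σ)))
         × (∃[ α ] (0# ≤ α × (∀ σ → v₂ σ ≡ α * v σ))))

  cutVolume : ∀ {d n} → Chain d n → Simplex d n → Carrier
  cutVolume C σ = if C σ then 1# else 0#

  -- dist(v₁,v₂) = +∞ : some ratio a/0 with a>0 occurs in one of the two maxima
  DistInfinite : ∀ {d n} → (Simplex d n → Carrier) → (Simplex d n → Carrier) → Set
  DistInfinite v₁ v₂ =
    ∃[ σ ] ((0# < v₁ σ × v₂ σ ≡ 0#) ⊎ (0# < v₂ σ × v₁ σ ≡ 0#))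

module Submission where

-- Two facts about a set C of d-simplices drive the proof.
-- (1) Let w be a volume vanishing off C.  A homology ∂B = ∂X with B supported off C
--     gives the cycle B + X, whose volume inequality only sees the simplices of X.
--     Hence w is 0 on simplices of C null homologous modulo the complement, and
--     w σ₁ ≤ w σ₂ whenever σ₁ ∼ σ₂.  On a hypercut w is therefore a multiple of the cut
--     volume; this gives "⇐" and the distance statement.
-- (2) For "⇒" let C be the support of v.  If σ₁, σ₂ ∈ C were not homologous modulo
--     the complement, the Fredholm alternative over Z₂ produces a coboundary D ⊆ C with
--     D σ₁ ≠ D σ₂.  A coboundary meets every cycle evenly, so ½·1_D and v − ½·1_D are
--     volumes; their sum is v, yet ½·1_D is not proportional to v: v is not extremal.

open import Defs
open import Algebra.Bundles using (CommutativeRing)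
open import Data.Bool using (Bool; true; false; _∧_; not; _xor_; if_then_else_)
open import Data.Bool.Properties
  using ( xor-assoc; xor-comm; xor-same; xor-identityʳ; xor-inverseʳ; ∧-zeroʳ; ∧-inverseʳ
        ; ∧-distribˡ-xor; ∧-distribʳ-xor; ∧-conicalˡ; ∧-conicalʳ; ¬-not; not-injective
        ; xor-∧-commutativeRing )
  renaming (_≟_ to _≟ᵇ_)
open import Algebra.Properties.CommutativeSemigroup
  (CommutativeRing.+-commutativeSemigroup xor-∧-commutativeRing) using (interchange)
open import Data.Empty using (⊥-elim)
open import Data.Fin.Subset using (Subset; ∣_∣)
open import Data.List using (List; []; _∷_; _++_; map; mapMaybe; foldr; filter)
open import Data.List.Membership.Propositional using (_∈_; find)
open import Data.List.Membership.Propositional.Properties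
  using (∈-map⁺; ∈-map⁻; ∈-++⁺ˡ; ∈-++⁺ʳ; ∈-filter⁺; ∈-filter⁻)
open import Data.List.Relation.Unary.All as All using (All; []; _∷_)
open import Data.List.Relation.Unary.All.Properties using (¬Any⇒All¬)
open import Data.List.Relation.Unary.AllPairs using ([]; _∷_)
open import Data.List.Relation.Unary.Any as Any using (Any; here; there; any?; satisfied)
open import Data.List.Relation.Unary.Any.Properties as AnyP using ()
open import Data.List.Relation.Unary.Unique.Propositional using (Unique)
open import Data.List.Relation.Unary.Unique.Propositional.Properties as Unique using ()
open import Data.Maybe using (Maybe; just; nothing)
open import Data.Maybe.Relation.Unary.Any as MaybeAny using (just)
open import Data.Nat using (ℕ; zero; suc) renaming (_≟_ to _≟ℕ_)
open import Data.Nat.Properties using (≡-irrelevant)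
open import Data.Product using (Σ; ∃-syntax; _×_; _,_; proj₁; proj₂)
open import Data.Sum using (_⊎_; inj₁; inj₂)
open import Data.Vec using ([]; _∷_)
open import Data.Vec.Properties using (∷-injectiveʳ)
open import Function.Bundles using (_⇔_; mk⇔)
open import Relation.Nullary using (¬_; Dec; yes; no; does)
open import Relation.Binary.PropositionalEquality

true≢false : true ≢ false
true≢false ()

⊕ : {X : Set} → List X → (X → Bool) → Bool
⊕ L g = foldr (λ t acc → g t xor acc) false L

module _ {X : Set} where

  ⊕-zero : ∀ (L : List X) → ⊕ L (λ _ → false) ≡ false
  ⊕-zero []      = refl
  ⊕-zero (_ ∷ L) = ⊕-zero L

  ⊕-cong : ∀ (L : List X) {g h : X → Bool} → (∀ t → g t ≡ h t) → ⊕ L g ≡ ⊕ L h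
  ⊕-cong []      g≡h = refl
  ⊕-cong (t ∷ L) g≡h = cong₂ _xor_ (g≡h t) (⊕-cong L g≡h)

  ⊕-xor : ∀ (L : List X) (g h : X → Bool) → ⊕ L (λ t → g t xor h t) ≡ ⊕ L g xor ⊕ L h
  ⊕-xor []      g h = refl
  ⊕-xor (t ∷ L) g h =
    trans (cong ((g t xor h t) xor_) (⊕-xor L g h)) (interchange (g t) (h t) (⊕ L g) (⊕ L h))

  ⊕-∧ˡ : ∀ (L : List X) b (g : X → Bool) → ⊕ L (λ t → b ∧ g t) ≡ b ∧ ⊕ L g
  ⊕-∧ˡ []      b g = sym (∧-zeroʳ b)
  ⊕-∧ˡ (t ∷ L) b g =
    trans (cong ((b ∧ g t) xor_) (⊕-∧ˡ L b g)) (sym (∧-distribˡ-xor b (g t) (⊕ L g)))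

  ⊕-∧ʳ : ∀ (L : List X) b (g : X → Bool) → ⊕ L (λ t → g t ∧ b) ≡ ⊕ L g ∧ b
  ⊕-∧ʳ []      b g = refl
  ⊕-∧ʳ (t ∷ L) b g =
    trans (cong ((g t ∧ b) xor_) (⊕-∧ʳ L b g)) (sym (∧-distribʳ-xor b (g t) (⊕ L g)))

  ⊕-++ : ∀ (L M : List X) (g : X → Bool) → ⊕ (L ++ M) g ≡ ⊕ L g xor ⊕ M g
  ⊕-++ []      M g = refl
  ⊕-++ (t ∷ L) M g = trans (cong (g t xor_) (⊕-++ L M g)) (sym (xor-assoc (g t) (⊕ L g) (⊕ M g)))

  ⊕-witness : ∀ (L : List X) (g : X → Bool) → ⊕ L g ≡ true → Any (λ t → g t ≡ true) L
  ⊕-witness (t ∷ L) g odd with g t in gt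
  ... | true  = here gt
  ... | false = there (⊕-witness L g odd)

⊕-swap : ∀ {X Y : Set} (L : List X) (M : List Y) (m : X → Y → Bool) →
         ⊕ L (λ t → ⊕ M (m t)) ≡ ⊕ M (λ s → ⊕ L (λ t → m t s))
⊕-swap []      M m = sym (⊕-zero M)
⊕-swap (t ∷ L) M m =
  trans (cong (⊕ M (m t) xor_) (⊕-swap L M m)) (sym (⊕-xor M (m t) (λ s → ⊕ L (λ t′ → m t′ s))))

-- By induction on xs: when a separator S of x for xs fails on the new column t, a
-- separator S′ of x + t for xs either works for x directly or combines to S ++ S′.
module _ {X Y : Set} (g : X → Y → Bool) (ys : List Y) where

  Represents : List X → (Y → Bool) → Set
  Represents T x = ∀ {y} → y ∈ ys → x y ≡ ⊕ T (λ t → g t y)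

  Separates : List Y → List X → (Y → Bool) → Set
  Separates S xs x = All (λ t → ⊕ S (g t) ≡ false) xs × ⊕ S x ≡ true

  private
    xor-cancel : ∀ a b → (a xor b) xor b ≡ a
    xor-cancel a b = trans (xor-assoc a b b) (trans (cong (a xor_) (xor-same b)) (xor-identityʳ a))

    ⊕-shift : ∀ S (x h : Y → Bool) → ⊕ S x ≡ ⊕ S (λ y → x y xor h y) xor ⊕ S h
    ⊕-shift S x h = trans (⊕-cong S (λ y → sym (xor-cancel (x y) (h y)))) (⊕-xor S (λ y → x y xor h y) h)

  fredholm : ∀ (xs : List X) (x : Y → Bool) →
             (∃[ T ] (All (_∈ xs) T × Represents T x)) ⊎ (∃[ S ] Separates S xs x)
  fredholm [] x with any? (λ y → x y ≟ᵇ true) ys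
  ... | yes some = let y , xy = satisfied some in inj₂ (y ∷ [] , [] , trans (xor-identityʳ (x y)) xy)
  ... | no  none = inj₁ ([] , [] , λ y∈ → ¬-not (All.lookup (¬Any⇒All¬ ys none) y∈))
  fredholm (t ∷ xs) x with fredholm xs x
  ... | inj₁ (T , T⊆ , rep) = inj₁ (T , All.map there T⊆ , rep)
  ... | inj₂ (S , orth , sep) with ⊕ S (g t) in St
  ...   | false = inj₂ (S , St ∷ orth , sep)
  ...   | true with fredholm xs (λ y → x y xor g t y)
  ...     | inj₁ (T , T⊆ , rep) =
            inj₁ (t ∷ T , here refl ∷ All.map there T⊆ ,
                  λ {y} y∈ → trans (sym (xor-cancel (x y) (g t y)))
                                   (trans (cong (_xor g t y) (rep y∈)) (xor-comm _ (g t y))))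
  ...     | inj₂ (S′ , orth′ , sep′) with ⊕ S′ (g t) in S′t
  ...       | false = inj₂ (S′ , S′t ∷ orth′ , trans (⊕-shift S′ x (g t)) (cong₂ _xor_ sep′ S′t))
  ...       | true  =
              inj₂ (S ++ S′ ,
                    trans (⊕-++ S S′ (g t)) (cong₂ _xor_ St S′t)
                      ∷ All.zipWith (λ {s} (p , q) → trans (⊕-++ S S′ (g s)) (cong₂ _xor_ p q)) (orth , orth′) ,
                    trans (⊕-++ S S′ x) (cong₂ _xor_ sep (trans (⊕-shift S′ x (g t)) (cong₂ _xor_ sep′ S′t))))

module _ {X A : Set} (_∙_ : A → A → A) (ε : A)
         (identityˡ : ∀ a → ε ∙ a ≡ a) (identityʳ : ∀ a → a ∙ ε ≡ a) where

  private
    fold : List X → (X → A) → A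
    fold L f = foldr (λ t acc → f t ∙ acc) ε L

    fold-ε : ∀ L (f : X → A) → All (λ t → f t ≡ ε) L → fold L f ≡ ε
    fold-ε []      f []           = refl
    fold-ε (t ∷ L) f (ft≡ε ∷ rest) = trans (cong₂ _∙_ ft≡ε (fold-ε L f rest)) (identityˡ ε)

  fold-single : ∀ {L} → Unique L → ∀ {σ} → σ ∈ L → (f : X → A) → (∀ t → t ≢ σ → f t ≡ ε) →
                foldr (λ t acc → f t ∙ acc) ε L ≡ f σ
  fold-single {σ ∷ L} (σ∉L ∷ _) (here refl) f off =
    trans (cong (f σ ∙_) (fold-ε L f (All.map (λ σ≢t → off _ (≢-sym σ≢t)) σ∉L))) (identityʳ (f σ))
  fold-single {t ∷ L} (t∉L ∷ uniq) (there σ∈L) f off =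
    trans (cong (_∙ fold L f) (off t (All.lookup t∉L σ∈L))) (trans (identityˡ _) (fold-single uniq σ∈L f off))

eqB-refl : ∀ {n} (s : Subset n) → eqB s s ≡ true
eqB-refl []          = refl
eqB-refl (true ∷ s)  = eqB-refl s
eqB-refl (false ∷ s) = eqB-refl s

eqB-sound : ∀ {n} (s t : Subset n) → eqB s t ≡ true → s ≡ t
eqB-sound []          []          _  = refl
eqB-sound (true ∷ s)  (true ∷ t)  eq = cong (true ∷_) (eqB-sound s t eq)
eqB-sound (false ∷ s) (false ∷ t) eq = cong (false ∷_) (eqB-sound s t eq)

-- a k-set is determined by its underlying subset (sizes are proof-irrelevant)
KSet-≡ : ∀ {k n} {σ τ : KSet k n} → proj₁ σ ≡ proj₁ τ → σ ≡ τ
KSet-≡ {σ = s , p} {.s , q} refl = cong (s ,_) (≡-irrelevant p q)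

eqB⇒≡ : ∀ {k n} (σ τ : KSet k n) → eqB (proj₁ σ) (proj₁ τ) ≡ true → σ ≡ τ
eqB⇒≡ σ τ eq = KSet-≡ (eqB-sound _ _ eq)

≢⇒eqB : ∀ {k n} {σ τ : KSet k n} → σ ≢ τ → eqB (proj₁ σ) (proj₁ τ) ≡ false
≢⇒eqB {σ = σ} {τ} σ≢τ = ¬-not (λ eq → σ≢τ (eqB⇒≡ σ τ eq))

eqB≡false⇒≢ : ∀ {k n} {σ τ : KSet k n} → eqB (proj₁ σ) (proj₁ τ) ≡ false → σ ≢ τ
eqB≡false⇒≢ {σ = σ} eq refl with trans (sym (eqB-refl (proj₁ σ))) eq
... | ()

allSubsets-complete : ∀ {n} (s : Subset n) → s ∈ allSubsets n
allSubsets-complete []          = here refl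
allSubsets-complete (false ∷ s) = ∈-++⁺ˡ (∈-map⁺ (false ∷_) (allSubsets-complete s))
allSubsets-complete {suc n} (true ∷ s) =
  ∈-++⁺ʳ (map (false ∷_) (allSubsets n)) (∈-map⁺ (true ∷_) (allSubsets-complete s))

allSubsets-unique : ∀ n → Unique (allSubsets n)
allSubsets-unique zero    = [] ∷ []
allSubsets-unique (suc n) =
  Unique.++⁺ (Unique.map⁺ ∷-injectiveʳ (allSubsets-unique n)) (Unique.map⁺ ∷-injectiveʳ (allSubsets-unique n))
             disjoint
  where
  disjoint : ∀ {s} → ¬ (s ∈ map (false ∷_) (allSubsets n) × s ∈ map (true ∷_) (allSubsets n))
  disjoint (s∈₀ , s∈₁) with ∈-map⁻ (false ∷_) s∈₀ | ∈-map⁻ (true ∷_) s∈₁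
  ... | _ , _ , refl | _ , _ , ()

mapMaybe-unique : ∀ {A B : Set} (f : A → Maybe B) → (∀ {x y z} → f x ≡ just z → f y ≡ just z → x ≡ y) →
                  ∀ {xs} → Unique xs → Unique (mapMaybe f xs)
mapMaybe-unique f inj {[]}     []            = []
mapMaybe-unique f inj {x ∷ xs} (x∉xs ∷ uniq) with f x in fx
... | nothing = mapMaybe-unique f inj uniq
... | just z  = fresh x∉xs ∷ mapMaybe-unique f inj uniq
  where
  fresh : ∀ {ys} → All (x ≢_) ys → All (z ≢_) (mapMaybe f ys)
  fresh {[]}     []           = []
  fresh {y ∷ ys} (x≢y ∷ x∉ys) with f y in fy
  ... | nothing = fresh x∉ys
  ... | just w  = (λ { refl → x≢y (inj fx fy) }) ∷ fresh x∉ys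

private
  -- allKSets k n is mapMaybe of a local partial map keeping the subsets of size k;
  -- this equation names that map so that its two properties can be stated
  kSetsBy : ∀ k n → Σ (Subset n → Maybe (KSet k n)) (λ pick → allKSets k n ≡ mapMaybe pick (allSubsets n))
  kSetsBy k n = _ , refl

  pick : ∀ k n → Subset n → Maybe (KSet k n)
  pick k n = proj₁ (kSetsBy k n)

  pick-sound : ∀ {k n} s {σ} → pick k n s ≡ just σ → proj₁ σ ≡ s
  pick-sound {k} s eq with ∣ s ∣ ≟ℕ k
  pick-sound s refl | yes _ = refl

  pick-complete : ∀ {k n} (σ : KSet k n) → pick k n (proj₁ σ) ≡ just σ
  pick-complete {k} (s , p) with ∣ s ∣ ≟ℕ k
  ... | yes q = cong just (KSet-≡ refl)
  ... | no ¬p = ⊥-elim (¬p p)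

allKSets-complete : ∀ {k n} (σ : KSet k n) → σ ∈ allKSets k n
allKSets-complete {k} {n} σ =
  AnyP.mapMaybe⁺ (pick k n) (allSubsets n)
    (AnyP.map⁺ (Any.map (λ { refl → subst (MaybeAny.Any (σ ≡_)) (sym (pick-complete σ)) (just refl) })
                        (allSubsets-complete (proj₁ σ))))

allKSets-unique : ∀ k n → Unique (allKSets k n)
allKSets-unique k n =
  mapMaybe-unique (pick k n) (λ {x} {y} px py → trans (sym (pick-sound x px)) (pick-sound y py))
                  (allSubsets-unique n)

⊕-at : ∀ {k n} (σ : KSet k n) (g : KSet k n → Bool) →
       ⊕ (allKSets k n) (λ t → eqB (proj₁ t) (proj₁ σ) ∧ g t) ≡ g σ
⊕-at {k} {n} σ g =
  trans (fold-single _xor_ false (λ _ → refl) xor-identityʳ (allKSets-unique k n) (allKSets-complete σ) _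
                     (λ t t≢σ → cong (_∧ g t) (≢⇒eqB t≢σ)))
        (cong (_∧ g σ) (eqB-refl (proj₁ σ)))

module FieldFacts (F : OrderedField) where
  open OrderedField F
  open Volumes F using (sumL)

  +-identityʳ : ∀ a → a + 0# ≡ a
  +-identityʳ a = trans (+-comm a 0#) (+-identityˡ a)

  *-identityʳ : ∀ a → a * 1# ≡ a
  *-identityʳ a = trans (*-comm a 1#) (*-identityˡ a)

  distribˡ : ∀ a b c → a * (b + c) ≡ (a * b) + (a * c)
  distribˡ a b c = trans (*-comm a (b + c)) (trans (distribʳ b c a) (cong₂ _+_ (*-comm b a) (*-comm c a)))

  +-idem⇒0 : ∀ a → a + a ≡ a → a ≡ 0#
  +-idem⇒0 a a+a≡a = begin
    a                ≡⟨ sym (+-identityˡ a) ⟩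
    0# + a           ≡⟨ cong (_+ a) (sym (-‿inverseˡ a)) ⟩
    ((- a) + a) + a  ≡⟨ +-assoc (- a) a a ⟩
    (- a) + (a + a)  ≡⟨ cong ((- a) +_) a+a≡a ⟩
    (- a) + a        ≡⟨ -‿inverseˡ a ⟩
    0#               ∎
    where open ≡-Reasoning

  *-zeroˡ : ∀ a → 0# * a ≡ 0#
  *-zeroˡ a = +-idem⇒0 (0# * a) (trans (sym (distribʳ 0# 0# a)) (cong (_* a) (+-identityˡ 0#)))

  *-zeroʳ : ∀ a → a * 0# ≡ 0#
  *-zeroʳ a = trans (*-comm a 0#) (*-zeroˡ a)

  +-mono : ∀ {a b c d} → a ≤ b → c ≤ d → a + c ≤ b + d
  +-mono {a} {b} {c} {d} a≤b c≤d =
    ≤-trans (+-mono-≤ c a≤b) (subst₂ _≤_ (+-comm c b) (+-comm d b) (+-mono-≤ b c≤d))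

  -- if 1 ≤ 0 then 0 ≤ -1, hence 0 ≤ (-1)·(-1) = 1
  0≤1 : 0# ≤ 1#
  0≤1 with ≤-total 0# 1#
  ... | inj₁ 0≤1 = 0≤1
  ... | inj₂ 1≤0 = subst (0# ≤_) [-1]²≡1 (*-nonneg 0≤-1 0≤-1)
    where
    0≤-1 : 0# ≤ - 1#
    0≤-1 = subst₂ _≤_ (trans (+-comm 1# (- 1#)) (-‿inverseˡ 1#)) (+-identityˡ (- 1#)) (+-mono-≤ (- 1#) 1≤0)
    [-1]²≡1 : (- 1#) * (- 1#) ≡ 1#
    [-1]²≡1 = begin
      (- 1#) * (- 1#)                         ≡⟨ sym (+-identityʳ _) ⟩
      (- 1#) * (- 1#) + 0#                    ≡⟨ cong (_ +_) (sym (-‿inverseˡ 1#)) ⟩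
      (- 1#) * (- 1#) + ((- 1#) + 1#)         ≡⟨ sym (+-assoc _ (- 1#) 1#) ⟩
      ((- 1#) * (- 1#) + (- 1#)) + 1#         ≡⟨ cong (λ z → ((- 1#) * (- 1#) + z) + 1#) (sym (*-identityˡ (- 1#))) ⟩
      ((- 1#) * (- 1#) + 1# * (- 1#)) + 1#    ≡⟨ cong (_+ 1#) (sym (distribʳ (- 1#) 1# (- 1#))) ⟩
      ((- 1#) + 1#) * (- 1#) + 1#             ≡⟨ cong (λ z → z * (- 1#) + 1#) (-‿inverseˡ 1#) ⟩
      0# * (- 1#) + 1#                        ≡⟨ cong (_+ 1#) (*-zeroˡ (- 1#)) ⟩
      0# + 1#                                 ≡⟨ +-identityˡ 1# ⟩
      1#                                      ∎
      where open ≡-Reasoning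

  1≰0 : ¬ (1# ≤ 0#)
  1≰0 1≤0 = 0≢1 (≤-antisym 0≤1 1≤0)

  -- Equality is decidable: ≤-total is a function, so on a ≡ b the two calls
  -- ≤-total a b and ≤-total b a coincide and cannot fall on different sides.
  private
    inj₁≢inj₂ : ∀ {A B : Set} {x : A} {y : B} → inj₁ x ≢ inj₂ y
    inj₁≢inj₂ ()

  _≟_ : ∀ a b → Dec (a ≡ b)
  a ≟ b with ≤-total a b in ab | ≤-total b a in ba
  ... | inj₁ a≤b | inj₁ b≤a = yes (≤-antisym a≤b b≤a)
  ... | inj₂ b≤a | inj₂ a≤b = yes (≤-antisym a≤b b≤a)
  ... | inj₁ _   | inj₂ _   = no λ { refl → inj₁≢inj₂ (trans (sym ab) ba) }
  ... | inj₂ _   | inj₁ _   = no λ { refl → inj₁≢inj₂ (trans (sym ba) ab) }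

  ≤-respˡ : ∀ {a b c} → a ≡ b → a ≤ c → b ≤ c
  ≤-respˡ refl a≤c = a≤c

  nonneg-+ : ∀ {a b} → 0# ≤ a → 0# ≤ b → 0# ≤ a + b
  nonneg-+ 0≤a 0≤b = ≤-respˡ (+-identityˡ 0#) (+-mono 0≤a 0≤b)

  nonneg-sum-zero : ∀ {a b} → 0# ≤ a → 0# ≤ b → a + b ≡ 0# → a ≡ 0#
  nonneg-sum-zero {a} 0≤a 0≤b a+b≡0 = ≤-antisym (subst₂ _≤_ (+-identityʳ a) a+b≡0 (+-mono (≤-refl a) 0≤b)) 0≤a

  -- ½: 1 + 1 is invertible since it is ≥ 1 > 0, and its inverse is nonnegative
  half : Σ Carrier (λ h → h + h ≡ 1# × 0# ≤ h)
  half with inverse (1# + 1#) 2≢0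
    where
    2≢0 : 1# + 1# ≢ 0#
    2≢0 2≡0 = 1≰0 (subst₂ _≤_ (+-identityˡ 1#) 2≡0 (+-mono 0≤1 (≤-refl 1#)))
  ... | h , h*2≡1 = h , h+h≡1 , 0≤h
    where
    h+h≡1 : h + h ≡ 1#
    h+h≡1 = trans (cong₂ _+_ (sym (*-identityʳ h)) (sym (*-identityʳ h))) (trans (sym (distribˡ h 1# 1#)) h*2≡1)
    0≤h : 0# ≤ h
    0≤h with ≤-total 0# h
    ... | inj₁ 0≤h = 0≤h
    ... | inj₂ h≤0 = ⊥-elim (1≰0 (subst₂ _≤_ h+h≡1 (+-identityˡ 0#) (+-mono h≤0 h≤0)))

  ½ : Carrier
  ½ = proj₁ half

  ½+½ : ½ + ½ ≡ 1#
  ½+½ = proj₁ (proj₂ half)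

  0≤½ : 0# ≤ ½
  0≤½ = proj₂ (proj₂ half)

  ½≢0 : ½ ≢ 0#
  ½≢0 ½≡0 = 0≢1 (trans (sym (+-identityˡ 0#)) (trans (cong₂ _+_ (sym ½≡0) (sym ½≡0)) ½+½))

  ½≤1 : ½ ≤ 1#
  ½≤1 = subst₂ _≤_ (+-identityˡ ½) ½+½ (+-mono 0≤½ (≤-refl ½))

  module _ {X : Set} where

    sum-nonneg : ∀ (L : List X) {f : X → Carrier} → (∀ t → 0# ≤ f t) → 0# ≤ sumL L f
    sum-nonneg []      nonneg = ≤-refl 0#
    sum-nonneg (t ∷ L) nonneg = nonneg-+ (nonneg t) (sum-nonneg L nonneg)

    sum-zero : ∀ (L : List X) {f : X → Carrier} → (∀ t → f t ≡ 0#) → sumL L f ≡ 0#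
    sum-zero []      allZero = refl
    sum-zero (t ∷ L) allZero = trans (cong₂ _+_ (allZero t) (sum-zero L allZero)) (+-identityˡ 0#)

    sum-mono : ∀ (L : List X) {f g : X → Carrier} → (∀ t → f t ≤ g t) → sumL L f ≤ sumL L g
    sum-mono []      f≤g = ≤-refl 0#
    sum-mono (t ∷ L) f≤g = +-mono (f≤g t) (sum-mono L f≤g)

    sum-single : ∀ {L : List X} → Unique L → ∀ {σ} → σ ∈ L → (f : X → Carrier) →
                 (∀ t → t ≢ σ → f t ≡ 0#) → sumL L f ≡ f σ
    sum-single = fold-single _+_ 0# +-identityˡ +-identityʳ

    term≤sum : ∀ (L : List X) {f : X → Carrier} → (∀ t → 0# ≤ f t) → ∀ {t} → t ∈ L → f t ≤ sumL L f
    term≤sum (t ∷ L) {f} nonneg (here refl) =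
      ≤-respˡ (+-identityʳ (f t)) (+-mono (≤-refl (f t)) (sum-nonneg L nonneg))
    term≤sum (s ∷ L) nonneg (there t∈L) = ≤-respˡ (+-identityˡ _) (+-mono (nonneg s) (term≤sum L nonneg t∈L))

    terms≤sum : ∀ (L : List X) {f : X → Carrier} → (∀ t → 0# ≤ f t) →
                ∀ {t u} → t ∈ L → u ∈ L → t ≢ u → f t + f u ≤ sumL L f
    terms≤sum (s ∷ L) nonneg (here refl) (here refl) t≢u = ⊥-elim (t≢u refl)
    terms≤sum (s ∷ L) {f} nonneg (here refl) (there u∈L) t≢u = +-mono (≤-refl (f s)) (term≤sum L nonneg u∈L)
    terms≤sum (s ∷ L) {f} nonneg {t} (there t∈L) (here refl) t≢u =
      ≤-respˡ (+-comm (f s) (f t)) (+-mono (≤-refl (f s)) (term≤sum L nonneg t∈L))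
    terms≤sum (s ∷ L) nonneg (there t∈L) (there u∈L) t≢u =
      ≤-respˡ (+-identityˡ _) (+-mono (nonneg s) (terms≤sum L nonneg t∈L u∈L t≢u))

    sum-support : ∀ (L : List X) {f : X → Carrier} (q : X → Bool) → (∀ t → q t ≡ false → f t ≡ 0#) →
                  sumL L f ≢ 0# → Any (λ t → q t ≡ true) L
    sum-support []      q off sum≢0 = ⊥-elim (sum≢0 refl)
    sum-support (t ∷ L) {f} q off sum≢0 with q t in qt
    ... | true  = here qt
    ... | false = there (sum-support L q off λ sum≡0 →
                    sum≢0 (trans (cong₂ _+_ (off t qt) sum≡0) (+-identityˡ 0#)))

module Complex (d n : ℕ) where

  boundary-xor : ∀ (A B : Chain d n) τ → boundary (λ σ → A σ xor B σ) τ ≡ boundary A τ xor boundary B τ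
  boundary-xor A B τ =
    trans (⊕-cong (simplices d n) (λ σ → ∧-distribʳ-xor (subB (proj₁ τ) (proj₁ σ)) (A σ) (B σ)))
          (⊕-xor (simplices d n) (λ σ → A σ ∧ subB (proj₁ τ) (proj₁ σ)) (λ σ → B σ ∧ subB (proj₁ τ) (proj₁ σ)))

  boundary-⊕ : ∀ {X : Set} (T : List X) (c : X → Chain d n) τ →
               boundary (λ σ → ⊕ T (λ t → c t σ)) τ ≡ ⊕ T (λ t → boundary (c t) τ)
  boundary-⊕ T c τ =
    trans (⊕-cong (simplices d n) (λ σ → sym (⊕-∧ʳ T (subB (proj₁ τ) (proj₁ σ)) (λ t → c t σ))))
          (⊕-swap (simplices d n) T (λ σ t → c t σ ∧ subB (proj₁ τ) (proj₁ σ)))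

  boundary-single : ∀ σ τ → boundary (single σ) τ ≡ subB (proj₁ τ) (proj₁ σ)
  boundary-single σ τ = ⊕-at {suc d} {n} σ (λ t → subB (proj₁ τ) (proj₁ t))

  homology-cycle : ∀ (B X : Chain d n) → (∀ τ → boundary B τ ≡ boundary X τ) → IsCycle (λ σ → B σ xor X σ)
  homology-cycle B X ∂B≡∂X τ =
    trans (boundary-xor B X τ) (trans (cong (_xor boundary X τ) (∂B≡∂X τ)) (xor-same (boundary X τ)))

  -- the coboundary of a (d-1)-cochain, given as a list S of faces: the parity of
  -- the faces of σ that are listed in S
  coboundary : List (Face d n) → Chain d n
  coboundary S σ = ⊕ S (λ φ → subB (proj₁ φ) (proj₁ σ))

  coboundary-adjoint : ∀ (S : List (Face d n)) (X : Chain d n) →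
                       ⊕ S (boundary X) ≡ ⊕ (simplices d n) (λ t → X t ∧ coboundary S t)
  coboundary-adjoint S X =
    trans (sym (⊕-swap (simplices d n) S (λ t φ → X t ∧ subB (proj₁ φ) (proj₁ t))))
          (⊕-cong (simplices d n) (λ t → ⊕-∧ˡ S (X t) (λ φ → subB (proj₁ φ) (proj₁ t))))

  Even : Chain d n → Set
  Even D = ∀ Z → IsCycle Z → ⊕ (simplices d n) (λ t → Z t ∧ D t) ≡ false

  coboundary-even : ∀ S → Even (coboundary S)
  coboundary-even S Z cycle =
    trans (sym (coboundary-adjoint S Z)) (trans (⊕-cong S cycle) (⊕-zero S))

  CycleClosed : Chain d n → Set
  CycleClosed D = ∀ Z → IsCycle Z → ∀ σ → Z σ ≡ true → D σ ≡ true →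
                  ∃[ t ] (Z t ≡ true × D t ≡ true × t ≢ σ)

  -- The sum of Z ∧ D splits into the term at σ, which is 1, and the others, which
  -- must then sum to 1.
  even⇒cycleClosed : ∀ {D} → Even D → CycleClosed D
  even⇒cycleClosed {D} even Z cycle σ Zσ Dσ = partner (satisfied (⊕-witness (simplices d n) others others≡true))
    where
    Σ⊕ : Chain d n → Bool
    Σ⊕ = ⊕ (simplices d n)
    Q : Chain d n
    Q t = Z t ∧ D t
    E : Chain d n
    E t = eqB (proj₁ t) (proj₁ σ)
    others : Chain d n
    others t = not (E t) ∧ Q t
    partner : ∃[ t ] (others t ≡ true) → ∃[ t ] (Z t ≡ true × D t ≡ true × t ≢ σ)
    partner (t , hit) =
      let Qt = ∧-conicalʳ (not (E t)) (Q t) hit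
      in  t , ∧-conicalˡ (Z t) (D t) Qt , ∧-conicalʳ (Z t) (D t) Qt
            , eqB≡false⇒≢ (not-injective (∧-conicalˡ (not (E t)) (Q t) hit))
    split : ∀ t → Q t ≡ (E t ∧ Q t) xor others t
    split t = sym (trans (sym (∧-distribʳ-xor (Q t) (E t) (not (E t)))) (cong (_∧ Q t) (xor-inverseʳ (E t))))
    others≡true : ⊕ (simplices d n) others ≡ true
    others≡true = not-injective (begin
      not (Σ⊕ others)                                ≡⟨⟩
      true xor Σ⊕ others                             ≡⟨ cong (_xor Σ⊕ others) (sym (trans (⊕-at σ Q) (cong₂ _∧_ Zσ Dσ))) ⟩
      Σ⊕ (λ t → E t ∧ Q t) xor Σ⊕ others             ≡⟨ sym (⊕-xor (simplices d n) (λ t → E t ∧ Q t) others) ⟩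
      Σ⊕ (λ t → (E t ∧ Q t) xor others t)            ≡⟨ sym (⊕-cong (simplices d n) split) ⟩
      Σ⊕ Q                                           ≡⟨ even Z cycle ⟩
      false                                          ∎)
      where open ≡-Reasoning

  span-or-separated : ∀ (A : Chain d n) (x : Face d n → Bool) →
    InSpan A x ⊎ ∃[ S ] ((∀ σ → A σ ≡ true → coboundary S σ ≡ false) × ⊕ S x ≡ true)
  span-or-separated A x with fredholm (λ t → boundary (single t)) (allKSets d n) columnsOfA x
    where
    columnsOfA : List (Simplex d n)
    columnsOfA = filter (λ σ → A σ ≟ᵇ true) (simplices d n)
  ... | inj₁ (T , T⊆A , represents) = inj₁ (B , B⊆A , ∂B≡x)
    where
    B : Chain d n
    B σ = ⊕ T (λ t → single t σ)
    B⊆A : ∀ σ → B σ ≡ true → A σ ≡ true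
    B⊆A σ Bσ =
      let t , t∈T , σ≐t = find (⊕-witness T (λ t → single t σ) Bσ)
          At = proj₂ (∈-filter⁻ (λ σ → A σ ≟ᵇ true) {xs = simplices d n} (All.lookup T⊆A t∈T))
      in  subst (λ u → A u ≡ true) (sym (eqB⇒≡ σ t σ≐t)) At
    ∂B≡x : ∀ τ → boundary B τ ≡ x τ
    ∂B≡x τ = trans (boundary-⊕ T single τ) (sym (represents (allKSets-complete τ)))
  ... | inj₂ (S , orthogonal , separates) = inj₂ (S , vanishes , separates)
    where
    vanishes : ∀ σ → A σ ≡ true → coboundary S σ ≡ false
    vanishes σ Aσ =
      trans (⊕-cong S (λ φ → sym (boundary-single σ φ)))
            (All.lookup orthogonal (∈-filter⁺ (λ σ → A σ ≟ᵇ true) (allKSets-complete σ) Aσ))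

  coboundary-pair : ∀ S σ₁ σ₂ →
    ⊕ S (boundary (λ σ → single σ₁ σ xor single σ₂ σ)) ≡ coboundary S σ₁ xor coboundary S σ₂
  coboundary-pair S σ₁ σ₂ =
    trans (coboundary-adjoint S X)
    (trans (⊕-cong (simplices d n) (λ t → ∧-distribʳ-xor (coboundary S t) (single σ₁ t) (single σ₂ t)))
    (trans (⊕-xor (simplices d n) (λ t → single σ₁ t ∧ coboundary S t) (λ t → single σ₂ t ∧ coboundary S t))
           (cong₂ _xor_ (⊕-at σ₁ (coboundary S)) (⊕-at σ₂ (coboundary S)))))
    where
    X : Chain d n
    X σ = single σ₁ σ xor single σ₂ σ

module VolumeFacts (F : OrderedField) (d n : ℕ) where
  open OrderedField F
  open Volumes F
  open FieldFacts F
  open Complex d n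

  others : Chain d n → Simplex d n → (Simplex d n → Carrier) → Simplex d n → Carrier
  others Z σ v t = if Z t ∧ not (eqB (proj₁ t) (proj₁ σ)) then v t else 0#

  if-zero : ∀ b {a} → a ≡ 0# → (if b then a else 0#) ≡ 0#
  if-zero true  a≡0 = a≡0
  if-zero false a≡0 = refl

  others-nonneg : ∀ {v} → (∀ t → 0# ≤ v t) → ∀ Z σ t → 0# ≤ others Z σ v t
  others-nonneg nonneg Z σ t with Z t ∧ not (eqB (proj₁ t) (proj₁ σ))
  ... | true  = nonneg t
  ... | false = ≤-refl 0#

  others-at : ∀ {v Z σ t} → Z t ≡ true → t ≢ σ → others Z σ v t ≡ v t
  others-at {v} {σ = σ} {t} Zt t≢σ = cong (λ b → if b then v t else 0#) (cong₂ _∧_ Zt (cong not (≢⇒eqB t≢σ)))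

  partner≤others : ∀ {v} → (∀ t → 0# ≤ v t) → ∀ {Z σ t} → Z t ≡ true → t ≢ σ →
                   v t ≤ sumL (simplices d n) (others Z σ v)
  partner≤others {v} nonneg {Z} {σ} {t} Zt t≢σ =
    ≤-respˡ (others-at {v} {Z} {σ} Zt t≢σ) (term≤sum (simplices d n) (others-nonneg nonneg Z σ) (allKSets-complete t))

  -- If ∂B = ∂X with B supported off C, and w is a volume vanishing off C, then the
  -- volume inequality for the cycle B + X at σ ∈ C ∩ X only sees the terms on X.
  homology-bound : ∀ {C w} → IsVolume w → (∀ σ → C σ ≡ false → w σ ≡ 0#) →
                   ∀ X → InSpan (compl C) (boundary X) → ∀ σ → C σ ≡ true → X σ ≡ true →
                   w σ ≤ sumL (simplices d n) (others X σ w)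
  homology-bound {C} {w} (nonneg , inequality) vanish X (B , B⊆C̄ , ∂B≡∂X) σ Cσ Xσ =
    ≤-trans (inequality Z (homology-cycle B X ∂B≡∂X) σ Zσ) (sum-mono (simplices d n) dropB)
    where
    Z : Chain d n
    Z t = B t xor X t
    B-off-C : ∀ t → B t ≡ true → C t ≡ false
    B-off-C t Bt = not-injective (B⊆C̄ t Bt)
    Zσ : Z σ ≡ true
    Zσ = cong₂ _xor_ (¬-not λ Bσ → true≢false (trans (sym Cσ) (B-off-C σ Bσ))) Xσ
    dropB : ∀ t → others Z σ w t ≤ others X σ w t
    dropB t with B t in Bt
    ... | false = ≤-refl _
    ... | true  = ≤-respˡ (sym (if-zero _ (vanish t (B-off-C t Bt)))) (others-nonneg nonneg X σ t)

  null-homologous⇒zero : ∀ {C w} → IsVolume w → (∀ σ → C σ ≡ false → w σ ≡ 0#) →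
                         ∀ σ → C σ ≡ true → NullHomologous (compl C) σ → w σ ≤ 0#
  null-homologous⇒zero {C} {w} volume vanish σ Cσ null =
    ≤-trans (homology-bound volume vanish (single σ) null σ Cσ (eqB-refl (proj₁ σ)))
            (≤-respˡ (sym (sum-zero (simplices d n) noTerms)) (≤-refl 0#))
    where
    noTerms : ∀ t → others (single σ) σ w t ≡ 0#
    noTerms t = cong (λ b → if b then w t else 0#) (∧-inverseʳ (eqB (proj₁ t) (proj₁ σ)))

  homologous⇒≤ : ∀ {C w} → IsVolume w → (∀ σ → C σ ≡ false → w σ ≡ 0#) →
                 ∀ σ₁ σ₂ → C σ₁ ≡ true → HomEquiv (compl C) σ₁ σ₂ → w σ₁ ≤ w σ₂
  homologous⇒≤ {C} {w} volume vanish σ₁ σ₂ C₁ hom with eqB (proj₁ σ₁) (proj₁ σ₂) in same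
  ... | true  = subst (λ u → w σ₁ ≤ w u) (eqB⇒≡ σ₁ σ₂ same) (≤-refl (w σ₁))
  ... | false =
    ≤-trans (homology-bound volume vanish X hom σ₁ C₁ (cong₂ _xor_ (eqB-refl (proj₁ σ₁)) same))
            (≤-respˡ (sym (trans (sum-single (allKSets-unique (suc d) n) (allKSets-complete σ₂) _ off) atσ₂))
                     (≤-refl (w σ₂)))
    where
    X : Chain d n
    X t = single σ₁ t xor single σ₂ t
    E : Chain d n
    E t = eqB (proj₁ t) (proj₁ σ₁)
    off : ∀ t → t ≢ σ₂ → others X σ₁ w t ≡ 0#
    off t t≢σ₂ = cong (λ b → if b then w t else 0#) (begin
      (E t xor eqB (proj₁ t) (proj₁ σ₂)) ∧ not (E t)   ≡⟨ cong (λ b → (E t xor b) ∧ not (E t)) (≢⇒eqB t≢σ₂) ⟩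
      (E t xor false) ∧ not (E t)                     ≡⟨ cong (_∧ not (E t)) (xor-identityʳ (E t)) ⟩
      E t ∧ not (E t)                                 ≡⟨ ∧-inverseʳ (E t) ⟩
      false                                           ∎)
      where open ≡-Reasoning
    σ₂≢σ₁ : σ₂ ≢ σ₁
    σ₂≢σ₁ σ₂≡σ₁ = eqB≡false⇒≢ same (sym σ₂≡σ₁)
    atσ₂ : others X σ₁ w σ₂ ≡ w σ₂
    atσ₂ = cong (λ b → if b then w σ₂ else 0#)
                (cong₂ (λ a b → (a xor b) ∧ not a) (≢⇒eqB σ₂≢σ₁) (eqB-refl (proj₁ σ₂)))

module Extremal (F : OrderedField) (d n : ℕ) where
  open OrderedField F
  open Volumes F
  open FieldFacts F
  open Complex d n
  open VolumeFacts F d n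

  cut-on : ∀ (C : Chain d n) {σ} → C σ ≡ true → cutVolume C σ ≡ 1#
  cut-on C Cσ = cong (λ b → if b then 1# else 0#) Cσ

  cut-off : ∀ (C : Chain d n) {σ} → C σ ≡ false → cutVolume C σ ≡ 0#
  cut-off C Cσ = cong (λ b → if b then 1# else 0#) Cσ

  hypercut-scaling : ∀ {C} → IsHypercut C → ∀ {w} → IsVolume w → (∀ σ → C σ ≡ false → w σ ≡ 0#) →
                     ∀ σ₀ → C σ₀ ≡ true → ∀ σ → w σ ≡ w σ₀ * cutVolume C σ
  hypercut-scaling {C} (_ , _ , homologous) {w} volume vanish σ₀ C₀ σ with C σ in Cσ
  ... | true  = trans (≤-antisym (homologous⇒≤ volume vanish σ σ₀ Cσ (homologous σ σ₀ Cσ C₀))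
                                 (homologous⇒≤ volume vanish σ₀ σ C₀ (homologous σ₀ σ C₀ Cσ)))
                      (sym (*-identityʳ (w σ₀)))
  ... | false = trans (vanish σ Cσ) (sym (*-zeroʳ (w σ₀)))

  -- If cutVolume C is a volume, C is cycle-closed: the volume inequality for a cycle Z
  -- at σ ∈ C has left side 1, so some other simplex of Z lies in C.
  cut-cycleClosed : ∀ {C v} → IsVolume v → (∀ σ → v σ ≡ cutVolume C σ) → CycleClosed C
  cut-cycleClosed {C} {v} (_ , inequality) v≡cut Z cycle σ Zσ Cσ =
    partner (satisfied (sum-support (simplices d n) q off sum≢0))
    where
    q : Chain d n
    q t = (Z t ∧ not (eqB (proj₁ t) (proj₁ σ))) ∧ C t
    off : ∀ t → q t ≡ false → others Z σ v t ≡ 0#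
    off t qt with Z t ∧ not (eqB (proj₁ t) (proj₁ σ))
    ... | false = refl
    ... | true  = trans (v≡cut t) (cut-off C qt)
    sum≢0 : sumL (simplices d n) (others Z σ v) ≢ 0#
    sum≢0 sum≡0 = 1≰0 (subst₂ _≤_ (trans (v≡cut σ) (cut-on C Cσ)) sum≡0 (inequality Z cycle σ Zσ))
    partner : ∃[ t ] (q t ≡ true) → ∃[ t ] (Z t ≡ true × C t ≡ true × t ≢ σ)
    partner (t , qt) =
      let Zt∧t≢σ = ∧-conicalˡ (Z t ∧ not (eqB (proj₁ t) (proj₁ σ))) (C t) qt
      in  t , ∧-conicalˡ (Z t) _ Zt∧t≢σ , ∧-conicalʳ _ (C t) qt
            , eqB≡false⇒≢ (not-injective (∧-conicalʳ (Z t) (not (eqB (proj₁ t) (proj₁ σ))) Zt∧t≢σ))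

  halfOn : Chain d n → Simplex d n → Carrier
  halfOn D σ = if D σ then ½ else 0#

  cutMinusHalf : Chain d n → Chain d n → Simplex d n → Carrier
  cutMinusHalf C D σ = if C σ then (if D σ then ½ else 1#) else 0#

  split-cut : ∀ {C D : Chain d n} → (∀ σ → D σ ≡ true → C σ ≡ true) →
              ∀ σ → cutVolume C σ ≡ halfOn D σ + cutMinusHalf C D σ
  split-cut {C} {D} D⊆C σ with C σ in Cσ | D σ in Dσ
  ... | true  | true  = sym ½+½
  ... | true  | false = sym (+-identityˡ 1#)
  ... | false | false = sym (+-identityˡ 0#)
  ... | false | true  with trans (sym (D⊆C σ Dσ)) Cσ
  ...   | ()

  -- ½ on a cycle-closed set is a volume: a cycle through σ ∈ D has a second simplex in D
  halfOn-volume : ∀ {D} → CycleClosed D → IsVolume (halfOn D)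
  halfOn-volume {D} closed = nonneg , inequality
    where
    nonneg : ∀ σ → 0# ≤ halfOn D σ
    nonneg σ with D σ
    ... | true  = 0≤½
    ... | false = ≤-refl 0#
    inequality : ∀ Z → IsCycle Z → ∀ σ → Z σ ≡ true → halfOn D σ ≤ sumL (simplices d n) (others Z σ (halfOn D))
    inequality Z cycle σ Zσ with D σ in Dσ
    ... | false = sum-nonneg (simplices d n) (others-nonneg nonneg Z σ)
    ... | true  = let t , Zt , Dt , t≢σ = closed Z cycle σ Zσ Dσ
                  in  ≤-respˡ (cong (λ b → if b then ½ else 0#) Dt) (partner≤others nonneg {Z} {σ} Zt t≢σ)

  -- For σ ∈ C on a cycle Z there is a second t ∈ C on
  -- Z; its value ½ or 1 suffices unless σ ∉ D has value 1 and t ∈ D has value ½, in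
  -- which case a second t′ ∈ D on Z supplies the missing ½.
  cutMinusHalf-volume : ∀ {C D} → CycleClosed C → CycleClosed D → (∀ σ → D σ ≡ true → C σ ≡ true) →
                        IsVolume (cutMinusHalf C D)
  cutMinusHalf-volume {C} {D} closedC closedD D⊆C = nonneg , inequality
    where
    v : Simplex d n → Carrier
    v = cutMinusHalf C D
    on-C : ∀ {t} → C t ≡ true → ∀ {b} → D t ≡ b → v t ≡ (if b then ½ else 1#)
    on-C {t} Ct Dt = cong₂ (λ c b → if c then (if b then ½ else 1#) else 0#) Ct Dt
    nonneg : ∀ σ → 0# ≤ v σ
    nonneg σ with C σ | D σ
    ... | true  | true  = 0≤½
    ... | true  | false = 0≤1
    ... | false | _     = ≤-refl 0#
    ½≤ : ∀ b → ½ ≤ (if b then ½ else 1#)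
    ½≤ true  = ≤-refl ½
    ½≤ false = ½≤1
    inequality : ∀ Z → IsCycle Z → ∀ σ → Z σ ≡ true → v σ ≤ sumL (simplices d n) (others Z σ v)
    inequality Z cycle σ Zσ with C σ in Cσ
    ... | false = sum-nonneg (simplices d n) (others-nonneg nonneg Z σ)
    ... | true with closedC Z cycle σ Zσ Cσ
    ...   | t , Zt , Ct , t≢σ with D σ in Dσ | D t in Dt
    ...     | true  | b     = ≤-trans (subst (½ ≤_) (sym (on-C Ct Dt)) (½≤ b)) (partner≤others nonneg {Z} {σ} Zt t≢σ)
    ...     | false | false = ≤-respˡ (on-C Ct Dt) (partner≤others nonneg {Z} {σ} Zt t≢σ)
    ...     | false | true  with closedD Z cycle t Zt Dt
    ...       | t′ , Zt′ , Dt′ , t′≢t =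
      ≤-respˡ (trans (cong₂ _+_ (half-at Zt t≢σ Ct Dt) (half-at Zt′ t′≢σ (D⊆C t′ Dt′) Dt′)) ½+½)
              (terms≤sum (simplices d n) (others-nonneg nonneg Z σ) (allKSets-complete t) (allKSets-complete t′)
                         (λ t≡t′ → t′≢t (sym t≡t′)))
      where
      t′≢σ : t′ ≢ σ
      t′≢σ t′≡σ = true≢false (trans (sym Dt′) (trans (cong D t′≡σ) Dσ))
      half-at : ∀ {u} → Z u ≡ true → u ≢ σ → C u ≡ true → D u ≡ true → others Z σ v u ≡ ½
      half-at Zu u≢σ Cu Du = trans (others-at {v} {Z} {σ} Zu u≢σ) (on-C Cu Du)

  -- An extremal cut volume cannot be split along a cycle-closed D ⊆ C: writing it
  -- as halfOn D + cutMinusHalf C D forces halfOn D = α · cutVolume C, so D is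
  -- constant on C.
  extremal⇒unsplittable : ∀ {C D v} → IsExtremal v → (∀ σ → v σ ≡ cutVolume C σ) →
                          CycleClosed D → (∀ σ → D σ ≡ true → C σ ≡ true) →
                          ∀ σ₁ σ₂ → C σ₁ ≡ true → C σ₂ ≡ true → D σ₁ ≡ D σ₂
  extremal⇒unsplittable {C} {D} {v} (volume , _ , extremal) v≡cut closedD D⊆C σ₁ σ₂ C₁ C₂
    with extremal (halfOn D) (cutMinusHalf C D)
                  (halfOn-volume closedD) (cutMinusHalf-volume (cut-cycleClosed volume v≡cut) closedD D⊆C)
                  (λ σ → trans (v≡cut σ) (split-cut D⊆C σ))
  ... | (α , _ , halfOn≡αv) , _ = halfOn-injective (trans (equals-α σ₁ C₁) (sym (equals-α σ₂ C₂)))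
    where
    equals-α : ∀ σ → C σ ≡ true → halfOn D σ ≡ α
    equals-α σ Cσ = trans (halfOn≡αv σ) (trans (cong (α *_) (trans (v≡cut σ) (cut-on C Cσ))) (*-identityʳ α))
    halfOn-injective : halfOn D σ₁ ≡ halfOn D σ₂ → D σ₁ ≡ D σ₂
    halfOn-injective eq with D σ₁ | D σ₂
    ... | true  | true  = refl
    ... | false | false = refl
    ... | true  | false = ⊥-elim (½≢0 eq)
    ... | false | true  = ⊥-elim (½≢0 (sym eq))

  -- Null homologous simplices would
  -- have volume 0; two simplices σ₁, σ₂ of C that are not homologous modulo the
  -- complement are separated by a coboundary D ⊆ C, which extremality forbids.
  extremal⇒hypercut : ∀ {C v} → IsExtremal v → (∀ σ → v σ ≡ cutVolume C σ) → IsHypercut C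
  extremal⇒hypercut {C} {v} extremal@(volume , (σ₀ , vσ₀≢0) , _) v≡cut = nonempty , nonNull , homologous
    where
    vanish : ∀ σ → C σ ≡ false → v σ ≡ 0#
    vanish σ Cσ = trans (v≡cut σ) (cut-off C Cσ)
    nonempty : ∃[ σ ] C σ ≡ true
    nonempty = σ₀ , ¬-not (λ Cσ₀≡false → vσ₀≢0 (vanish σ₀ Cσ₀≡false))
    nonNull : ∀ σ → C σ ≡ true → ¬ NullHomologous (compl C) σ
    nonNull σ Cσ null =
      1≰0 (≤-respˡ (trans (v≡cut σ) (cut-on C Cσ)) (null-homologous⇒zero volume vanish σ Cσ null))
    homologous : ∀ σ₁ σ₂ → C σ₁ ≡ true → C σ₂ ≡ true → HomEquiv (compl C) σ₁ σ₂
    homologous σ₁ σ₂ C₁ C₂ with span-or-separated (compl C) (boundary (λ σ → single σ₁ σ xor single σ₂ σ))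
    ... | inj₁ inSpan = inSpan
    ... | inj₂ (S , vanishesOff , pairing) = ⊥-elim (true≢false (sym (begin
      false                                               ≡⟨ sym (xor-same (coboundary S σ₁)) ⟩
      coboundary S σ₁ xor coboundary S σ₁                 ≡⟨ cong (coboundary S σ₁ xor_) same ⟩
      coboundary S σ₁ xor coboundary S σ₂                 ≡⟨ sym (coboundary-pair S σ₁ σ₂) ⟩
      ⊕ S (boundary (λ σ → single σ₁ σ xor single σ₂ σ))  ≡⟨ pairing ⟩
      true                                                ∎)))
      where
      open ≡-Reasoning
      D⊆C : ∀ σ → coboundary S σ ≡ true → C σ ≡ true
      D⊆C σ Dσ = ¬-not (λ Cσ≡false → true≢false (trans (sym Dσ) (vanishesOff σ (cong not Cσ≡false))))
      same : coboundary S σ₁ ≡ coboundary S σ₂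
      same = extremal⇒unsplittable extremal v≡cut (even⇒cycleClosed (coboundary-even S)) D⊆C σ₁ σ₂ C₁ C₂

  -- Conversely a hypercut's cut volume is extremal: both summands of a decomposition
  -- vanish off C, hence are multiples of the cut volume.
  hypercut⇒extremal : ∀ {C v} → IsVolume v → IsHypercut C → (∀ σ → v σ ≡ cutVolume C σ) → IsExtremal v
  hypercut⇒extremal {C} {v} volume hypercut@((σ₀ , C₀) , _) v≡cut =
    volume , (σ₀ , λ vσ₀≡0 → 0≢1 (trans (sym vσ₀≡0) (trans (v≡cut σ₀) (cut-on C C₀)))) , decompose
    where
    proportional : ∀ {w} → IsVolume w → (∀ σ → C σ ≡ false → w σ ≡ 0#) →
                   ∃[ α ] (0# ≤ α × (∀ σ → w σ ≡ α * v σ))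
    proportional {w} w-volume vanish =
      w σ₀ , proj₁ w-volume σ₀ ,
      λ σ → trans (hypercut-scaling hypercut w-volume vanish σ₀ C₀ σ) (cong (w σ₀ *_) (sym (v≡cut σ)))
    decompose : ∀ v₁ v₂ → IsVolume v₁ → IsVolume v₂ → (∀ σ → v σ ≡ v₁ σ + v₂ σ) →
                (∃[ α ] (0# ≤ α × (∀ σ → v₁ σ ≡ α * v σ))) × (∃[ α ] (0# ≤ α × (∀ σ → v₂ σ ≡ α * v σ)))
    decompose v₁ v₂ volume₁ volume₂ v≡v₁+v₂ =
      proportional volume₁ (λ σ Cσ → nonneg-sum-zero (proj₁ volume₁ σ) (proj₁ volume₂ σ) (sum-off σ Cσ)) ,
      proportional volume₂ (λ σ Cσ → nonneg-sum-zero (proj₁ volume₂ σ) (proj₁ volume₁ σ)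
                                                     (trans (+-comm (v₂ σ) (v₁ σ)) (sum-off σ Cσ)))
      where
      sum-off : ∀ σ → C σ ≡ false → v₁ σ + v₂ σ ≡ 0#
      sum-off σ Cσ = trans (sym (v≡v₁+v₂ σ)) (trans (v≡cut σ) (cut-off C Cσ))

  -- A volume at finite distance from a hypercut's cut volume vanishes exactly off
  -- C, hence is a positive multiple of the cut volume.
  finiteDistance⇒proportional : ∀ {C} → IsHypercut C → ∀ v₁ → IsVolume v₁ → ¬ DistInfinite (cutVolume C) v₁ →
                                ∃[ α ] (0# < α × (∀ σ → v₁ σ ≡ α * cutVolume C σ))
  finiteDistance⇒proportional {C} hypercut@((σ₀ , C₀) , _) v₁ volume finite =
    v₁ σ₀ , (proj₁ volume σ₀ , positive) , hypercut-scaling hypercut volume vanish σ₀ C₀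
    where
    vanish : ∀ σ → C σ ≡ false → v₁ σ ≡ 0#
    vanish σ Cσ with v₁ σ ≟ 0#
    ... | yes v₁σ≡0 = v₁σ≡0
    ... | no  v₁σ≢0 = ⊥-elim (finite (σ , inj₂ ((proj₁ volume σ , λ 0≡v₁σ → v₁σ≢0 (sym 0≡v₁σ)) , cut-off C Cσ)))
    positive : 0# ≢ v₁ σ₀
    positive 0≡v₁σ₀ = finite (σ₀ , inj₁ (subst (0# <_) (sym (cut-on C C₀)) (0≤1 , 0≢1) , sym 0≡v₁σ₀))

  support : (Simplex d n → Carrier) → Chain d n
  support v σ = does (v σ ≟ 1#)

  zeroOne⇒cut : ∀ {v} → (∀ σ → v σ ≡ 0# ⊎ v σ ≡ 1#) → ∀ σ → v σ ≡ cutVolume (support v) σ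
  zeroOne⇒cut {v} zeroOne σ with v σ ≟ 1# | zeroOne σ
  ... | yes vσ≡1 | _          = vσ≡1
  ... | no  _    | inj₁ vσ≡0 = vσ≡0
  ... | no  vσ≢1 | inj₂ vσ≡1 = ⊥-elim (vσ≢1 vσ≡1)

  extremal⇔hypercut : ∀ v → (∀ σ → v σ ≡ 0# ⊎ v σ ≡ 1#) → IsVolume v →
                      (IsExtremal v ⇔ (∃[ C ] (IsHypercut C × (∀ σ → v σ ≡ cutVolume C σ))))
  extremal⇔hypercut v zeroOne volume = mk⇔
    (λ extremal → support v , extremal⇒hypercut extremal (zeroOne⇒cut zeroOne) , zeroOne⇒cut zeroOne)
    (λ (C , hypercut , v≡cut) → hypercut⇒extremal volume hypercut v≡cut)

mainTheorem10 : (F : OrderedField) → (d n : ℕ) →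
    let open OrderedField F
        open Volumes F
    in ((v : Simplex d n → Carrier) → (∀ σ → v σ ≡ 0# ⊎ v σ ≡ 1#) → IsVolume v →
          (IsExtremal v ⇔ (∃[ C ] (IsHypercut C × (∀ σ → v σ ≡ cutVolume C σ)))))
       × ((C : Chain d n) → IsHypercut C → (v₁ : Simplex d n → Carrier) → IsVolume v₁ →
          ¬ DistInfinite (cutVolume C) v₁ →
          ∃[ α ] (0# < α × (∀ σ → v₁ σ ≡ α * cutVolume C σ)))
mainTheorem10 F d n = extremal⇔hypercut , λ C hypercut → finiteDistance⇒proportional hypercut
  where open Extremal F d n
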